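{- Let $x,y$ be noncommuting invertible variables with $yx=qxy$. Then for all integers $n$ and $k$, $\binom{n}{k}_q = \{x^ky^{n-k}\}(x+y)^n.$
   Context: For an integer $n\ge 0$, $(a;q)_n=\prod_{j=0}^{n-1}(1-aq^j)$, and for $n<0$, $(a;q)_n=\prod_{j=1}^{|n|}\frac{1}{1-aq^{ -j}}$. For all integers $n,k$, $\binom{n}{k}_q := \lim_{a\to q} \frac{(a;q)_n}{(a;q)_k\,(a;q)_{n-k}}$ (a Laurent polynomial in $q$). Coefficient extraction: for $n\ge0$, $(x+y)^n$ is a noncommutative polynomial which, using $yx=qxy$, is written uniquely as $\sum_k c_k x^ky^{n-k}$, and $\{x^ky^{n-k}\}(x+y)^n:=c_k$. For $n<0$, $(x+y)^n$ can be expanded in two ways. First, writing $(x+y)^{ -1}=y^{ -1}(1+xy^{ -1})^{ -1}=y^{ -1}\sum_{j\ge0}(-1)^j(xy^{ -1})^j$ and taking the $|n|$-th power, then normal ordering with $yx=qxy$, gives $(x+y)^n=\sum_{k\ge0}a_kx^ky^{n-k}$. Second, writing $(x+y)^{ -1}=(1+x^{ -1}y)^{ -1}x^{ -1}=\sum_{j\ge0}(-1)^j(x^{ -1}y)^jx^{ -1}$, taking the $|n|$-th power and normal ordering gives $(x+y)^n=\sum_{k\le n}b_kx^ky^{n-k}$. Then $\{x^ky^{n-k}\}(x+y)^n:=a_k$ if $k\ge0$ and $:=b_k$ if $k<0$. (For $n\ge 0$ both expansions coincide with the polynomial.) -}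

module Defs where

open import Level using (Level)
open import Algebra.Bundles using (CommutativeRing)
open import Data.Nat as ℕ using (ℕ; zero; suc; _∸_; _<ᵇ_)
open import Data.Integer as ℤ using (ℤ; +_; -[1+_]; 0ℤ)
open import Data.Bool using (if_then_else_)
open import Data.Product using (_×_; _,_; proj₁; proj₂)

-- Everything is developed over an arbitrary commutative ring R of
-- coefficients, with a unit q (inverse q⁻) and, for the q-binomial,
-- a chosen family inv e of inverses of (1 - q^e) for e ≠ 0.
module QTorus {c ℓ : Level} (R : CommutativeRing c ℓ) (q q⁻ : CommutativeRing.Carrier R) where
  open CommutativeRing R

  pow : Carrier → ℕ → Carrier
  pow a zero    = 1#
  pow a (suc n) = pow a n * a

  qpow : ℤ → Carrier
  qpow (+ n)     = pow q n
  qpow -[1+ n ]  = pow q⁻ (suc n)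

  sgn : ℕ → Carrier
  sgn zero    = 1#
  sgn (suc j) = - sgn j

  sumTo : ℕ → (ℕ → Carrier) → Carrier
  sumTo zero    f = f 0
  sumTo (suc k) f = sumTo k f + f (suc k)

  prodN : ℕ → (ℕ → Carrier) → Carrier
  prodN zero    f = 1#
  prodN (suc s) f = prodN s f * f s

  δ : ℕ → ℕ → Carrier
  δ zero    zero    = 1#
  δ (suc i) (suc j) = δ i j
  δ _       _       = 0#

  -- Expansion A: homogeneous series  Σ_{k ≥ 0} a_k x^k y^{m-k}
  -- represented as (m , a), a : ℕ → R (index = exponent of x).
  SerA : Set c
  SerA = ℤ × (ℕ → Carrier)

  -- (x^i y^{m-i})(x^j y^{p-j}) = q^{(m-i) j} x^{i+j} y^{m+p-i-j}
  _*A_ : SerA → SerA → SerA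
  (m , a) *A (p , b) =
    (m ℤ.+ p , λ k → sumTo k (λ i → a i * b (k ∸ i) * qpow ((m ℤ.- + i) ℤ.* + (k ∸ i))))

  _+A_ : SerA → SerA → SerA
  (m , a) +A (_ , b) = (m , λ k → a k + b k)

  oneA : SerA
  oneA = (0ℤ , δ 0)

  powA : SerA → ℕ → SerA
  powA s zero    = oneA
  powA s (suc n) = powA s n *A s

  xA yA y⁻A : SerA
  xA  = (+ 1 , δ 1)
  yA  = (+ 1 , δ 0)
  y⁻A = (-[1+ 0 ] , δ 0)

  -- (x+y)^{-1} = y^{-1} Σ_{j≥0} (-1)^j (x y^{-1})^j ; the term (x y^{-1})^j
  -- only contributes to x-exponent j, so the coefficient of x^k is a finite sum.
  invA : SerA
  invA = y⁻A *A (0ℤ , λ k → sumTo k (λ j → sgn j * proj₂ (powA (xA *A y⁻A) j) k))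

  binPowA : ℤ → SerA
  binPowA (+ n)     = powA (xA +A yA) n
  binPowA -[1+ n ]  = powA invA (suc n)

  -- Expansion B: homogeneous series  Σ_{k ≤ m} b_k x^k y^{m-k}
  -- represented as (m , b), b : ℕ → R (index t = exponent of y, k = m - t).
  SerB : Set c
  SerB = ℤ × (ℕ → Carrier)

  -- (x^{m-s} y^s)(x^{p-t} y^t) = q^{s (p-t)} x^{m+p-s-t} y^{s+t}
  _*B_ : SerB → SerB → SerB
  (m , a) *B (p , b) =
    (m ℤ.+ p , λ u → sumTo u (λ s → a s * b (u ∸ s) * qpow (+ s ℤ.* (p ℤ.- + (u ∸ s)))))

  _+B_ : SerB → SerB → SerB
  (m , a) +B (_ , b) = (m , λ k → a k + b k)

  oneB : SerB
  oneB = (0ℤ , δ 0)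

  powB : SerB → ℕ → SerB
  powB s zero    = oneB
  powB s (suc n) = powB s n *B s

  xB yB x⁻B : SerB
  xB  = (+ 1 , δ 0)
  yB  = (+ 1 , δ 1)
  x⁻B = (-[1+ 0 ] , δ 0)

  -- (x+y)^{-1} = Σ_{j≥0} (-1)^j (x^{-1} y)^j x^{-1} ; (x^{-1}y)^j only
  -- contributes to y-exponent j.
  invB : SerB
  invB = (0ℤ , λ u → sumTo u (λ j → sgn j * proj₂ (powB (x⁻B *B yB) j) u)) *B x⁻B

  binPowB : ℤ → SerB
  binPowB (+ n)     = powB (xB +B yB) n
  binPowB -[1+ n ]  = powB invB (suc n)

  -- {x^k y^{n-k}} (x+y)^n  :=  a_k (k ≥ 0),  b_k (k < 0; zero if k > n)
  coeff : ℤ → ℤ → Carrier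
  coeff n (+ k)    = proj₂ (binPowA n) k
  coeff n -[1+ k ] with n ℤ.- -[1+ k ]
  ... | + t      = proj₂ (binPowB n) t
  ... | -[1+ _ ] = 0#

  -- q-binomial  lim_{a→q} (a;q)_n / ((a;q)_k (a;q)_{n-k}).
  -- Near a = q, (a;q)_m = (1 - a q^{-1})^{-pole m} · r_m(a) where the only
  -- factor vanishing at a = q is 1 - a q^{-1} (the j = 1 factor for m < 0),
  -- and r_m is regular and invertible at a = q with value val m.
  -- (inv e is the inverse of 1 - q^e, e ≠ 0.)
  module Binom (inv : ℤ → Carrier) where
    pole : ℤ → ℕ
    pole (+ _)     = 0
    pole -[1+ _ ]  = 1

    -- r_m(q)
    val : ℤ → Carrier
    val (+ s)     = prodN s (λ j → 1# - qpow (+ suc j))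
    -- m = -(s+1) : Π_{j=2}^{s+1} 1/(1 - q·q^{-j}) = Π_{i=1}^{s} inv(-i)
    val -[1+ s ]  = prodN s (λ i → inv -[1+ i ])

    -- 1 / r_m(q)
    valInv : ℤ → Carrier
    valInv (+ s)     = prodN s (λ j → inv (+ suc j))
    valInv -[1+ s ]  = prodN s (λ i → 1# - qpow -[1+ i ])

    -- the ratio behaves like (1 - a/q)^{pole k + pole (n-k) - pole n}
    -- times a function regular and invertible at a = q.
    qbinom : ℤ → ℤ → Carrier
    qbinom n k =
      if pole n <ᵇ pole k ℕ.+ pole (n ℤ.- k)
      then 0#
      else val n * valInv k * valInv (n ℤ.- k)

-- The anti-automorphism exchanging x and y turns the B-product into the A-product with the
-- factors swapped, so (x+y)^n has the same coefficient sequence c(n, -) in both expansions and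
-- {x^k y^(n-k)} (x+y)^n is c(n,k) for k ≥ 0 and c(n,n-k) for k < 0 (0 if k > n). The A-product
-- is associative and the geometric series defining (x+y)⁻¹ is a left inverse of x + y, so
-- multiplying by x + y on the right gives, for every integer n, the q-Pascal rule
--   c(n+1,k+1) = c(n,k+1) + q^(n-k) c(n,k),   c(n,0) = 1.
-- Induction then gives, with denominators cleared, c(N,K) (q;q)_K (q;q)_L = (q;q)_(K+L) for
-- N = K + L, c(N,K) = 0 for K > N, and c(-N-1,K) (q⁻¹;q⁻¹)_N (q;q)_K = (q⁻¹;q⁻¹)_(N+K), which
-- are the values of the limit defining the q-binomial in each sign case.

module Submission where

open import Defs
open import Level using (Level)
open import Algebra.Bundles using (CommutativeRing; RawRing)
open import Algebra.Solver.Ring.AlmostCommutativeRing using (_-Raw-AlmostCommutative⟶_; fromCommutativeRing)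
open import Data.Integer as ℤ using (ℤ; +_; -[1+_]; _⊖_; 0ℤ)
import Data.Integer.Properties as ℤ
open import Data.Maybe using (Maybe; just; nothing)
open import Data.Nat as ℕ using (ℕ; zero; suc; _∸_; _≤_; _<_; z≤n; s≤s; _<ᵇ_)
import Data.Nat.Properties as ℕ
open import Relation.Binary.PropositionalEquality as ≡ using (_≡_; _≢_)
open import Data.Integer.Tactic.RingSolver using (solve-∀)
open import Relation.Nullary using (yes; no; contradiction)
open import Data.Bool using (if_then_else_)
open import Data.Sum using (inj₁; inj₂)
open import Function using (_∘_)

-- Over an abstract ring the reflective solver cannot cancel coefficients such as 1# - 1#,
-- so Algebra.Solver.Ring is instantiated with ℤ as coefficient ring.
module IntegerCoefficients {c ℓ : Level} (R : CommutativeRing c ℓ) where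
  open CommutativeRing R hiding (zero)
  open import Algebra.Properties.Ring ring using (-0#≈0#; -‿involutive; -‿+-comm; -‿distribˡ-*)
  -- this _×_ has 1 × x = x definitionally, so that con (+ 1) evaluates to 1#
  open import Algebra.Properties.Semiring.Mult.TCOptimised semiring using (_×_; 1+×; ×-homo-+)
  open import Relation.Binary.Reasoning.Setoid setoid

  ⟦_⟧ℤ : ℤ → Carrier
  ⟦ + n ⟧ℤ      = n × 1#
  ⟦ -[1+ n ] ⟧ℤ = - (suc n × 1#)

  ⟦-⟧ℤ : ∀ i → ⟦ ℤ.- i ⟧ℤ ≈ - ⟦ i ⟧ℤ
  ⟦-⟧ℤ (+ zero)  = sym -0#≈0#
  ⟦-⟧ℤ (+ suc n) = refl
  ⟦-⟧ℤ -[1+ n ]  = sym (-‿involutive _)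

  ⟦⊖⟧ℤ : ∀ m n → ⟦ m ⊖ n ⟧ℤ ≈ m × 1# - n × 1#
  ⟦⊖⟧ℤ m       zero    = begin
    ⟦ m ⊖ 0 ⟧ℤ     ≡⟨ ≡.cong ⟦_⟧ℤ (ℤ.⊖-≥ {m} z≤n) ⟩
    m × 1#         ≈⟨ +-identityʳ _ ⟨
    m × 1# + 0#    ≈⟨ +-congˡ -0#≈0# ⟨
    m × 1# - 0#    ∎
  ⟦⊖⟧ℤ zero    (suc n) = sym (+-identityˡ _)
  ⟦⊖⟧ℤ (suc m) (suc n) = begin
    ⟦ suc m ⊖ suc n ⟧ℤ                 ≡⟨ ≡.cong ⟦_⟧ℤ (ℤ.[1+m]⊖[1+n]≡m⊖n m n) ⟩
    ⟦ m ⊖ n ⟧ℤ                         ≈⟨ ⟦⊖⟧ℤ m n ⟩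
    m × 1# - n × 1#                    ≈⟨ cancel 1# (m × 1#) (n × 1#) ⟨
    (1# + m × 1#) - (1# + n × 1#)      ≈⟨ +-cong (1+× m 1#) (-‿cong (1+× n 1#)) ⟨
    suc m × 1# - suc n × 1#            ∎
    where
    open import Algebra.Properties.CommutativeSemigroup +-commutativeSemigroup using (interchange)
    cancel : ∀ a b c → (a + b) - (a + c) ≈ b - c
    cancel a b c = begin
      (a + b) - (a + c)     ≈⟨ +-congˡ (-‿+-comm a c) ⟨
      (a + b) + (- a - c)   ≈⟨ interchange a b (- a) (- c) ⟩
      (a - a) + (b - c)     ≈⟨ +-congʳ (-‿inverseʳ a) ⟩
      0# + (b - c)          ≈⟨ +-identityˡ _ ⟩
      b - c                 ∎

  ⟦+⟧ℤ : ∀ i j → ⟦ i ℤ.+ j ⟧ℤ ≈ ⟦ i ⟧ℤ + ⟦ j ⟧ℤ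
  ⟦+⟧ℤ (+ m)    (+ n)    = ×-homo-+ 1# m n
  ⟦+⟧ℤ (+ m)    -[1+ n ] = ⟦⊖⟧ℤ m (suc n)
  ⟦+⟧ℤ -[1+ m ] (+ n)    = trans (⟦⊖⟧ℤ n (suc m)) (+-comm _ _)
  ⟦+⟧ℤ -[1+ m ] -[1+ n ] = begin
    - (suc (suc (m ℕ.+ n)) × 1#)          ≡⟨ ≡.cong (λ k → - (suc k × 1#)) (ℕ.+-suc m n) ⟨
    - ((suc m ℕ.+ suc n) × 1#)            ≈⟨ -‿cong (×-homo-+ 1# (suc m) (suc n)) ⟩
    - (suc m × 1# + suc n × 1#)           ≈⟨ -‿+-comm _ _ ⟨
    - (suc m × 1#) - (suc n × 1#)         ∎

  ⟦+*⟧ℤ : ∀ m j → ⟦ + m ℤ.* j ⟧ℤ ≈ m × 1# * ⟦ j ⟧ℤ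
  ⟦+*⟧ℤ zero    j = sym (zeroˡ _)
  ⟦+*⟧ℤ (suc m) j = begin
    ⟦ + suc m ℤ.* j ⟧ℤ             ≡⟨ ≡.cong ⟦_⟧ℤ (ℤ.suc-* (+ m) j) ⟩
    ⟦ j ℤ.+ + m ℤ.* j ⟧ℤ           ≈⟨ ⟦+⟧ℤ j (+ m ℤ.* j) ⟩
    ⟦ j ⟧ℤ + ⟦ + m ℤ.* j ⟧ℤ        ≈⟨ +-cong (sym (*-identityˡ _)) (⟦+*⟧ℤ m j) ⟩
    1# * ⟦ j ⟧ℤ + m × 1# * ⟦ j ⟧ℤ  ≈⟨ distribʳ _ _ _ ⟨
    (1# + m × 1#) * ⟦ j ⟧ℤ         ≈⟨ *-congʳ (1+× m 1#) ⟨
    suc m × 1# * ⟦ j ⟧ℤ            ∎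

  ⟦*⟧ℤ : ∀ i j → ⟦ i ℤ.* j ⟧ℤ ≈ ⟦ i ⟧ℤ * ⟦ j ⟧ℤ
  ⟦*⟧ℤ (+ m)    j = ⟦+*⟧ℤ m j
  ⟦*⟧ℤ -[1+ m ] j = begin
    ⟦ -[1+ m ] ℤ.* j ⟧ℤ         ≡⟨ ≡.cong ⟦_⟧ℤ (ℤ.neg-distribˡ-* (+ suc m) j) ⟨
    ⟦ ℤ.- (+ suc m ℤ.* j) ⟧ℤ    ≈⟨ ⟦-⟧ℤ (+ suc m ℤ.* j) ⟩
    - ⟦ + suc m ℤ.* j ⟧ℤ        ≈⟨ -‿cong (⟦+*⟧ℤ (suc m) j) ⟩
    - (suc m × 1# * ⟦ j ⟧ℤ)     ≈⟨ -‿distribˡ-* _ _ ⟩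
    - (suc m × 1#) * ⟦ j ⟧ℤ     ∎

  private
    ℤ-rawRing : RawRing _ _
    ℤ-rawRing = record
      { Carrier = ℤ ; _≈_ = _≡_ ; _+_ = ℤ._+_ ; _*_ = ℤ._*_ ; -_ = ℤ.-_ ; 0# = + 0 ; 1# = + 1 }

    homomorphism : ℤ-rawRing -Raw-AlmostCommutative⟶ fromCommutativeRing R
    homomorphism = record
      { ⟦_⟧ = ⟦_⟧ℤ ; +-homo = ⟦+⟧ℤ ; *-homo = ⟦*⟧ℤ ; -‿homo = ⟦-⟧ℤ ; 0-homo = refl ; 1-homo = refl }

    dec : ∀ i j → Maybe (⟦ i ⟧ℤ ≈ ⟦ j ⟧ℤ)
    dec i j with i ℤ.≟ j
    ... | yes ≡.refl = just refl
    ... | no _       = nothing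

  open import Algebra.Solver.Ring ℤ-rawRing (fromCommutativeRing R) homomorphism dec public


module SumsAndProducts {c ℓ : Level} (R : CommutativeRing c ℓ) (q q⁻ : CommutativeRing.Carrier R) where
  open CommutativeRing R hiding (zero)
  open QTorus R q q⁻
  open import Algebra.Properties.CommutativeSemigroup +-commutativeSemigroup using (interchange)
  open import Algebra.Properties.CommutativeSemigroup *-commutativeSemigroup using () renaming (interchange to *-interchange)
  open import Relation.Binary.Reasoning.Setoid setoid

  sumTo-cong : ∀ k {f g} → (∀ i → i ≤ k → f i ≈ g i) → sumTo k f ≈ sumTo k g
  sumTo-cong zero    f≈g = f≈g 0 z≤n
  sumTo-cong (suc k) f≈g = +-cong (sumTo-cong k (λ i i≤k → f≈g i (ℕ.m≤n⇒m≤1+n i≤k))) (f≈g (suc k) ℕ.≤-refl)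

  sumTo-zero : ∀ k {f} → (∀ i → i ≤ k → f i ≈ 0#) → sumTo k f ≈ 0#
  sumTo-zero zero    f≈0 = f≈0 0 z≤n
  sumTo-zero (suc k) f≈0 =
    trans (+-cong (sumTo-zero k (λ i i≤k → f≈0 i (ℕ.m≤n⇒m≤1+n i≤k))) (f≈0 (suc k) ℕ.≤-refl)) (+-identityʳ 0#)

  sumTo-+ : ∀ k f g → sumTo k (λ i → f i + g i) ≈ sumTo k f + sumTo k g
  sumTo-+ zero    f g = refl
  sumTo-+ (suc k) f g = trans (+-congʳ (sumTo-+ k f g)) (interchange _ _ _ _)

  sumTo-*ʳ : ∀ k f x → sumTo k f * x ≈ sumTo k (λ i → f i * x)
  sumTo-*ʳ zero    f x = refl
  sumTo-*ʳ (suc k) f x = trans (distribʳ _ _ _) (+-congʳ (sumTo-*ʳ k f x))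

  sumTo-*ˡ : ∀ k f x → x * sumTo k f ≈ sumTo k (λ i → x * f i)
  sumTo-*ˡ zero    f x = refl
  sumTo-*ˡ (suc k) f x = trans (distribˡ _ _ _) (+-congʳ (sumTo-*ˡ k f x))

  sumTo-suc : ∀ k f → sumTo (suc k) f ≈ f 0 + sumTo k (f ∘ suc)
  sumTo-suc zero    f = refl
  sumTo-suc (suc k) f = trans (+-congʳ (sumTo-suc k f)) (+-assoc _ _ _)

  sumTo-reverse : ∀ k f → sumTo k f ≈ sumTo k (λ i → f (k ∸ i))
  sumTo-reverse zero    f = refl
  sumTo-reverse (suc k) f =
    trans (+-congʳ (sumTo-reverse k f)) (trans (+-comm _ _) (sym (sumTo-suc k (λ i → f (suc k ∸ i)))))

  sumTo-interchange : ∀ k (h : ℕ → ℕ → Carrier) →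
    sumTo k (λ j → sumTo j (λ i → h i j)) ≈ sumTo k (λ i → sumTo (k ∸ i) (λ l → h i (i ℕ.+ l)))
  sumTo-interchange zero    h = refl
  sumTo-interchange (suc k) h = begin
    sumTo k (λ j → sumTo j (λ i → h i j)) + (sumTo k (λ i → h i (suc k)) + h (suc k) (suc k))
      ≈⟨ +-congʳ (sumTo-interchange k h) ⟩
    sumTo k (λ i → sumTo (k ∸ i) (row i)) + (sumTo k (λ i → h i (suc k)) + h (suc k) (suc k))
      ≈⟨ +-assoc _ _ _ ⟨
    sumTo k (λ i → sumTo (k ∸ i) (row i)) + sumTo k (λ i → h i (suc k)) + h (suc k) (suc k)
      ≈⟨ +-cong (sumTo-+ k _ _) (reflexive (≡.cong (h (suc k)) (ℕ.+-identityʳ (suc k)))) ⟨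
    sumTo k (λ i → sumTo (k ∸ i) (row i) + h i (suc k)) + row (suc k) 0
      ≈⟨ +-cong (sumTo-cong k (λ i i≤k → sym (row-step i i≤k)))
                (reflexive (≡.cong (λ m → sumTo m (row (suc k))) (≡.sym (ℕ.n∸n≡0 k)))) ⟩
    sumTo (suc k) (λ i → sumTo (suc k ∸ i) (row i)) ∎
    where
    row : ℕ → ℕ → Carrier
    row i l = h i (i ℕ.+ l)
    row-step : ∀ i → i ≤ k → sumTo (suc k ∸ i) (row i) ≈ sumTo (k ∸ i) (row i) + h i (suc k)
    row-step i i≤k rewrite ℕ.+-∸-assoc 1 i≤k =
      +-congˡ (reflexive (≡.cong (h i) (≡.trans (ℕ.+-suc i (k ∸ i)) (≡.cong suc (ℕ.m+[n∸m]≡n i≤k)))))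

  sumTo-last : ∀ k {f} → (∀ i → i < k → f i ≈ 0#) → sumTo k f ≈ f k
  sumTo-last zero    f≈0 = refl
  sumTo-last (suc k) f≈0 = trans (+-congʳ (sumTo-zero k (λ i i≤k → f≈0 i (s≤s i≤k)))) (+-identityˡ _)

  sumTo-head : ∀ k {f} → (∀ i → f (suc i) ≈ 0#) → sumTo k f ≈ f 0
  sumTo-head zero    f≈0 = refl
  sumTo-head (suc k) f≈0 = trans (sumTo-suc k _) (trans (+-congˡ (sumTo-zero k (λ i _ → f≈0 i))) (+-identityʳ _))

  prodN-inverse : ∀ n {f g} → (∀ i → f i * g i ≈ 1#) → prodN n f * prodN n g ≈ 1#
  prodN-inverse zero    fg≈1 = *-identityʳ 1#
  prodN-inverse (suc n) fg≈1 =
    trans (*-interchange _ _ _ _) (trans (*-cong (prodN-inverse n fg≈1) (fg≈1 n)) (*-identityʳ 1#))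

  pow-+ : ∀ a m n → pow a (m ℕ.+ n) ≈ pow a m * pow a n
  pow-+ a m zero    = trans (reflexive (≡.cong (pow a) (ℕ.+-identityʳ m))) (sym (*-identityʳ _))
  pow-+ a m (suc n) = trans (reflexive (≡.cong (pow a) (ℕ.+-suc m n))) (trans (*-congʳ (pow-+ a m n)) (*-assoc _ _ _))

module BinomialExpansion {ℓ₁ ℓ₂ : Level} (R : CommutativeRing ℓ₁ ℓ₂) (q q⁻ : CommutativeRing.Carrier R)
  (q*q⁻≈1 : CommutativeRing._≈_ R (CommutativeRing._*_ R q q⁻) (CommutativeRing.1# R)) where
  open CommutativeRing R hiding (zero)
  open import Data.Product using (_×_; _,_; proj₁; proj₂)
  open QTorus R q q⁻
  open SumsAndProducts R q q⁻
  open IntegerCoefficients R using (solve; _:+_; _:*_; :-_; _:-_; _:=_; con)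
  open import Algebra.Properties.CommutativeSemigroup *-commutativeSemigroup using () renaming (interchange to *-interchange)
  open import Relation.Binary.Reasoning.Setoid setoid

  private
    *-zeroˡ₂ : ∀ x y → 0# * x * y ≈ 0#
    *-zeroˡ₂ x y = trans (*-congʳ (zeroˡ x)) (zeroˡ y)

    *-identity₂ : ∀ x → 1# * x * 1# ≈ x
    *-identity₂ x = trans (*-identityʳ _) (*-identityˡ x)

    cancel-units : ∀ {g a a′ b b′ p} → a * a′ ≈ 1# → b * b′ ≈ 1# → g * a * b ≈ p → p * a′ * b′ ≈ g
    cancel-units {g} {a} {a′} {b} {b′} aa′≈1 bb′≈1 gab≈p = begin
      _ * a′ * b′          ≈⟨ *-congʳ (*-congʳ gab≈p) ⟨
      g * a * b * a′ * b′
        ≈⟨ solve 5 (λ g a b a′ b′ → g :* a :* b :* a′ :* b′ := g :* (a :* a′) :* (b :* b′)) refl g a b a′ b′ ⟩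
      g * (a * a′) * (b * b′) ≈⟨ *-cong (*-congˡ aa′≈1) bb′≈1 ⟩
      g * 1# * 1#          ≈⟨ trans (*-identityʳ _) (*-identityʳ g) ⟩
      g                    ∎

    [k+l]-k≡l : ∀ k l → k ℤ.+ l ℤ.- k ≡ l
    [k+l]-k≡l = solve-∀

    -[1+n]-k≡-[1+n+k] : ∀ n k → ℤ.- (+ 1 ℤ.+ n) ℤ.- k ≡ ℤ.- (+ 1 ℤ.+ (n ℤ.+ k))
    -[1+n]-k≡-[1+n+k] = solve-∀

    isolate : ∀ {x a b} → x ≈ a + b → a ≈ x - b
    isolate {x} {a} {b} x≈a+b = trans (solve 2 (λ a b → a := a :+ b :- b) refl a b) (+-congʳ (sym x≈a+b))

  qpow-≡ : ∀ {i j} → i ≡ j → qpow i ≈ qpow j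
  qpow-≡ = reflexive ∘ ≡.cong qpow

  qpow-⊖ : ∀ m n → qpow (m ⊖ n) ≈ pow q m * pow q⁻ n
  qpow-⊖ m       zero    = trans (qpow-≡ (ℤ.⊖-≥ {m} z≤n)) (sym (*-identityʳ _))
  qpow-⊖ zero    (suc n) = sym (*-identityˡ _)
  qpow-⊖ (suc m) (suc n) = begin
    qpow (suc m ⊖ suc n)             ≡⟨ ≡.cong qpow (ℤ.[1+m]⊖[1+n]≡m⊖n m n) ⟩
    qpow (m ⊖ n)                     ≈⟨ qpow-⊖ m n ⟩
    pow q m * pow q⁻ n               ≈⟨ *-identityʳ _ ⟨
    pow q m * pow q⁻ n * 1#          ≈⟨ *-congˡ q*q⁻≈1 ⟨
    pow q m * pow q⁻ n * (q * q⁻)    ≈⟨ *-interchange _ _ _ _ ⟩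
    pow q m * q * (pow q⁻ n * q⁻)    ∎

  qpow-+ : ∀ i j → qpow (i ℤ.+ j) ≈ qpow i * qpow j
  qpow-+ (+ m)    (+ n)    = pow-+ q m n
  qpow-+ (+ m)    -[1+ n ] = qpow-⊖ m (suc n)
  qpow-+ -[1+ m ] (+ n)    = trans (qpow-⊖ n (suc m)) (*-comm _ _)
  qpow-+ -[1+ m ] -[1+ n ] = trans (qpow-≡ (≡.cong -[1+_] (≡.sym (ℕ.+-suc m n)))) (pow-+ q⁻ (suc m) (suc n))

  qpow-inverse : ∀ i → qpow i * qpow (ℤ.- i) ≈ 1#
  qpow-inverse i = trans (sym (qpow-+ i (ℤ.- i))) (qpow-≡ (ℤ.+-inverseʳ i))

  infix 4 _≋_
  _≋_ : SerA → SerA → Set ℓ₂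
  s ≋ t = proj₁ s ≡ proj₁ t × (∀ k → proj₂ s k ≈ proj₂ t k)

  ≋-refl : ∀ {s} → s ≋ s
  ≋-refl = ≡.refl , λ _ → refl

  ≋-sym : ∀ {s t} → s ≋ t → t ≋ s
  ≋-sym (d , a≈b) = ≡.sym d , λ k → sym (a≈b k)

  ≋-trans : ∀ {s t u} → s ≋ t → t ≋ u → s ≋ u
  ≋-trans (d , a≈b) (d′ , b≈c) = ≡.trans d d′ , λ k → trans (a≈b k) (b≈c k)

  *A-cong : ∀ {s s′ t t′} → s ≋ t → s′ ≋ t′ → s *A s′ ≋ t *A t′
  *A-cong (d , a≈b) (d′ , a′≈b′) =
    ≡.cong₂ ℤ._+_ d d′ ,
    λ k → sumTo-cong k (λ i _ → *-cong (*-cong (a≈b i) (a′≈b′ (k ∸ i)))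
                                       (qpow-≡ (≡.cong (λ m → (m ℤ.- + i) ℤ.* + (k ∸ i)) d)))

  powA-cong : ∀ {s t} n → s ≋ t → powA s n ≋ powA t n
  powA-cong zero    s≋t = ≋-refl
  powA-cong (suc n) s≋t = *A-cong (powA-cong n s≋t) s≋t

  *B-flip : ∀ s t → s *B t ≋ t *A s
  *B-flip (m , a) (p , b) = ℤ.+-comm m p , λ u → trans (sumTo-reverse u _) (sumTo-cong u (λ i i≤u → begin
    a (u ∸ i) * b (u ∸ (u ∸ i)) * qpow (+ (u ∸ i) ℤ.* (p ℤ.- + (u ∸ (u ∸ i))))
      ≡⟨ ≡.cong (λ j → a (u ∸ i) * b j * qpow (+ (u ∸ i) ℤ.* (p ℤ.- + j))) (ℕ.m∸[m∸n]≡n i≤u) ⟩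
    a (u ∸ i) * b i * qpow (+ (u ∸ i) ℤ.* (p ℤ.- + i))
      ≈⟨ *-cong (*-comm _ _) (qpow-≡ (ℤ.*-comm (+ (u ∸ i)) (p ℤ.- + i))) ⟩
    b i * a (u ∸ i) * qpow ((p ℤ.- + i) ℤ.* + (u ∸ i)) ∎))

  *A-assoc : ∀ s t u → (s *A t) *A u ≋ s *A (t *A u)
  *A-assoc (m , a) (p , b) (r , c) = ℤ.+-assoc m p r , λ k → begin
    sumTo k (λ j → sumTo j (λ i → a i * b (j ∸ i) * qpow ((m ℤ.- + i) ℤ.* + (j ∸ i))) * c (k ∸ j)
                   * qpow ((m ℤ.+ p ℤ.- + j) ℤ.* + (k ∸ j)))
      ≈⟨ sumTo-cong k (λ j _ → trans (*-congʳ (sumTo-*ʳ j _ _)) (sumTo-*ʳ j _ _)) ⟩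
    sumTo k (λ j → sumTo j (λ i → term k i j))
      ≈⟨ sumTo-interchange k (term k) ⟩
    sumTo k (λ i → sumTo (k ∸ i) (λ l → term k i (i ℕ.+ l)))
      ≈⟨ sumTo-cong k (λ i _ → sumTo-cong (k ∸ i) (λ l l≤k∸i → regroup k i l l≤k∸i)) ⟩
    sumTo k (λ i → sumTo (k ∸ i) (λ l → a i * (b l * c (k ∸ i ∸ l) * qpow ((p ℤ.- + l) ℤ.* + (k ∸ i ∸ l)))
                                        * qpow ((m ℤ.- + i) ℤ.* + (k ∸ i))))
      ≈⟨ sumTo-cong k (λ i _ → trans (*-congʳ (sumTo-*ˡ (k ∸ i) _ (a i))) (sumTo-*ʳ (k ∸ i) _ _)) ⟨
    sumTo k (λ i → a i * sumTo (k ∸ i) (λ l → b l * c (k ∸ i ∸ l) * qpow ((p ℤ.- + l) ℤ.* + (k ∸ i ∸ l)))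
                   * qpow ((m ℤ.- + i) ℤ.* + (k ∸ i))) ∎
    where
    term : ℕ → ℕ → ℕ → Carrier
    term k i j = a i * b (j ∸ i) * qpow ((m ℤ.- + i) ℤ.* + (j ∸ i)) * c (k ∸ j) * qpow ((m ℤ.+ p ℤ.- + j) ℤ.* + (k ∸ j))

    -- the powers of q collected by normal-ordering (x^i y^(m-i)) (x^l y^(p-l)) (x^n y^(r-n)) in the two bracketings
    exponent : ∀ m p i l r →
      (m ℤ.- i) ℤ.* l ℤ.+ (m ℤ.+ p ℤ.- (i ℤ.+ l)) ℤ.* r ≡ (p ℤ.- l) ℤ.* r ℤ.+ (m ℤ.- i) ℤ.* (l ℤ.+ r)
    exponent = solve-∀

    regroup : ∀ k i l → l ≤ k ∸ i →
      term k i (i ℕ.+ l)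
        ≈ a i * (b l * c (k ∸ i ∸ l) * qpow ((p ℤ.- + l) ℤ.* + (k ∸ i ∸ l))) * qpow ((m ℤ.- + i) ℤ.* + (k ∸ i))
    regroup k i l l≤k∸i = begin
      term k i (i ℕ.+ l)
        ≡⟨ ≡.cong₂ (λ j n → a i * b j * qpow ((m ℤ.- + i) ℤ.* + j) * c n * qpow ((m ℤ.+ p ℤ.- + (i ℕ.+ l)) ℤ.* + n))
                   (ℕ.m+n∸m≡n i l) (≡.sym (ℕ.∸-+-assoc k i l)) ⟩
      a i * b l * qpow ((m ℤ.- + i) ℤ.* + l) * c n * qpow ((m ℤ.+ p ℤ.- + (i ℕ.+ l)) ℤ.* + n)
        ≈⟨ solve 5 (λ A B X C Y → A :* B :* X :* C :* Y := A :* (B :* C) :* (X :* Y)) refl _ _ _ _ _ ⟩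
      a i * (b l * c n) * (qpow ((m ℤ.- + i) ℤ.* + l) * qpow ((m ℤ.+ p ℤ.- + (i ℕ.+ l)) ℤ.* + n))
        ≈⟨ *-congˡ (sym (qpow-+ ((m ℤ.- + i) ℤ.* + l) _)) ⟩
      a i * (b l * c n) * qpow ((m ℤ.- + i) ℤ.* + l ℤ.+ (m ℤ.+ p ℤ.- (+ i ℤ.+ + l)) ℤ.* + n)
        ≡⟨ ≡.cong (λ e → a i * (b l * c n) * qpow e) (exponent m p (+ i) (+ l) (+ n)) ⟩
      a i * (b l * c n) * qpow ((p ℤ.- + l) ℤ.* + n ℤ.+ (m ℤ.- + i) ℤ.* + (l ℕ.+ n))
        ≡⟨ ≡.cong (λ j → a i * (b l * c n) * qpow ((p ℤ.- + l) ℤ.* + n ℤ.+ (m ℤ.- + i) ℤ.* + j))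
                  (ℕ.m+[n∸m]≡n l≤k∸i) ⟩
      a i * (b l * c n) * qpow ((p ℤ.- + l) ℤ.* + n ℤ.+ (m ℤ.- + i) ℤ.* + (k ∸ i))
        ≈⟨ *-congˡ (qpow-+ ((p ℤ.- + l) ℤ.* + n) _) ⟩
      a i * (b l * c n) * (qpow ((p ℤ.- + l) ℤ.* + n) * qpow ((m ℤ.- + i) ℤ.* + (k ∸ i)))
        ≈⟨ solve 5 (λ A B C Z W → A :* (B :* C) :* (Z :* W) := A :* (B :* C :* Z) :* W) refl _ _ _ _ _ ⟩
      a i * (b l * c n * qpow ((p ℤ.- + l) ℤ.* + n)) * qpow ((m ℤ.- + i) ℤ.* + (k ∸ i)) ∎
      where n = k ∸ i ∸ l

  *A-identityˡ : ∀ s → oneA *A s ≋ s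
  *A-identityˡ (m , a) = ℤ.+-identityˡ m , λ k → trans (sumTo-head k (λ _ → *-zeroˡ₂ _ _)) (*-identity₂ (a k))

  *B-identityˡ : ∀ s → oneB *B s ≋ s
  *B-identityˡ (m , a) = ℤ.+-identityˡ m , λ k → trans (sumTo-head k (λ _ → *-zeroˡ₂ _ _)) (*-identity₂ (a k))

  *A-identityʳ : ∀ s → s *A oneA ≋ s
  *A-identityʳ s = ≋-trans (≋-sym (*B-flip oneB s)) (*B-identityˡ s)

  powA-comm : ∀ s n → s *A powA s n ≋ powA s n *A s
  powA-comm s zero    = ≋-trans (*A-identityʳ s) (≋-sym (*A-identityˡ s))
  powA-comm s (suc n) = ≋-trans (≋-sym (*A-assoc s (powA s n) s)) (*A-cong (powA-comm s n) (≋-refl {s}))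

  powB≋powA : ∀ s n → powB s n ≋ powA s n
  powB≋powA s zero    = ≋-refl
  powB≋powA s (suc n) =
    ≋-trans (*B-flip (powB s n) s) (≋-trans (*A-cong (≋-refl {s}) (powB≋powA s n)) (powA-comm s n))

  invB≋invA : invB ≋ invA
  invB≋invA = ≋-trans (*B-flip geometricB x⁻B) (*A-cong (≋-refl {y⁻A}) geometricB≋geometricA)
    where
    geometricB geometricA : SerA
    geometricB = 0ℤ , λ u → sumTo u (λ j → sgn j * proj₂ (powB (x⁻B *B yB) j) u)
    geometricA = 0ℤ , λ k → sumTo k (λ j → sgn j * proj₂ (powA (xA *A y⁻A) j) k)

    geometricB≋geometricA : geometricB ≋ geometricA
    geometricB≋geometricA = ≡.refl , λ k → sumTo-cong k (λ j _ → *-congˡ (proj₂ (powers≋ j) k))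
      where
      powers≋ : ∀ j → powB (x⁻B *B yB) j ≋ powA (xA *A y⁻A) j
      powers≋ j = ≋-trans (powB≋powA _ j) (powA-cong j (*B-flip x⁻B yB))

  binPowB≋binPowA : ∀ n → binPowB n ≋ binPowA n
  binPowB≋binPowA (+ n)    = ≋-trans (powB≋powA _ n) (powA-cong n (≡.refl , λ k → +-comm (δ 0 k) (δ 1 k)))
  binPowB≋binPowA -[1+ n ] = ≋-trans (powB≋powA _ (suc n)) (powA-cong (suc n) invB≋invA)

  *B-coeff-zero : ∀ u s → proj₂ (u *B s) 0 ≈ proj₂ u 0 * proj₂ s 0
  *B-coeff-zero u s = *-identityʳ _

  *B-coeff-suc : ∀ u s → (∀ l → proj₂ u (2 ℕ.+ l) ≈ 0#) → ∀ K →
    proj₂ (u *B s) (suc K) ≈ proj₂ u 0 * proj₂ s (suc K) + proj₂ u 1 * proj₂ s K * qpow (proj₁ s ℤ.- + K)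
  *B-coeff-suc (m , u) (p , a) u≈0 K = begin
    sumTo (suc K) term
      ≈⟨ sumTo-suc K term ⟩
    term 0 + sumTo K (term ∘ suc)
      ≈⟨ +-cong (*-identityʳ _) (sumTo-head K (λ l → trans (*-congʳ (*-congʳ (u≈0 l))) (*-zeroˡ₂ _ _))) ⟩
    u 0 * a (suc K) + u 1 * a K * qpow (+ 1 ℤ.* (p ℤ.- + K))
      ≡⟨ ≡.cong (λ e → u 0 * a (suc K) + u 1 * a K * qpow e) (ℤ.*-identityˡ (p ℤ.- + K)) ⟩
    u 0 * a (suc K) + u 1 * a K * qpow (p ℤ.- + K) ∎
    where
    term : ℕ → Carrier
    term j = u j * a (suc K ∸ j) * qpow (+ j ℤ.* (p ℤ.- + (suc K ∸ j)))

  x+y : SerA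
  x+y = xA +A yA

  *A-x+y-coeff-zero : ∀ s → proj₂ (s *A x+y) 0 ≈ proj₂ s 0
  *A-x+y-coeff-zero s = begin
    proj₂ (s *A x+y) 0     ≈⟨ proj₂ (*B-flip x+y s) 0 ⟨
    proj₂ (x+y *B s) 0     ≈⟨ *B-coeff-zero x+y s ⟩
    (0# + 1#) * proj₂ s 0  ≈⟨ solve 1 (λ a → (con (+ 0) :+ con (+ 1)) :* a := a) refl _ ⟩
    proj₂ s 0              ∎

  *A-x+y-coeff-suc : ∀ s K → proj₂ (s *A x+y) (suc K) ≈ proj₂ s (suc K) + proj₂ s K * qpow (proj₁ s ℤ.- + K)
  *A-x+y-coeff-suc s K = begin
    proj₂ (s *A x+y) (suc K)  ≈⟨ proj₂ (*B-flip x+y s) (suc K) ⟨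
    proj₂ (x+y *B s) (suc K)  ≈⟨ *B-coeff-suc x+y s (λ _ → +-identityʳ 0#) K ⟩
    (0# + 1#) * a (suc K) + (1# + 0#) * a K * e
      ≈⟨ solve 3 (λ a b e → (con (+ 0) :+ con (+ 1)) :* a :+ (con (+ 1) :+ con (+ 0)) :* b :* e := a :+ b :* e) refl _ _ _ ⟩
    a (suc K) + a K * e       ∎
    where
    a = proj₂ s
    e = qpow (proj₁ s ℤ.- + K)

  δ-refl : ∀ i → δ i i ≈ 1#
  δ-refl zero    = refl
  δ-refl (suc i) = δ-refl i

  δ-≢ : ∀ {i j} → i ≢ j → δ i j ≈ 0#
  δ-≢ {zero}  {zero}  0≢0     = contradiction ≡.refl 0≢0
  δ-≢ {zero}  {suc j} _       = refl
  δ-≢ {suc i} {zero}  _       = refl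
  δ-≢ {suc i} {suc j} 1+i≢1+j = δ-≢ (1+i≢1+j ∘ ≡.cong suc)

  xy⁻¹ : SerA
  xy⁻¹ = xA *A y⁻A

  xy⁻¹-coeff : ∀ k → proj₂ xy⁻¹ k ≈ δ 1 k
  xy⁻¹-coeff k = trans (sym (proj₂ (*B-flip y⁻A xA) k)) (trans (sumTo-head k (λ _ → *-zeroˡ₂ _ _)) (*-identity₂ (δ 1 k)))

  -- q^(-k(k-1)/2), the scalar in (x y⁻¹)^k = q^(-k(k-1)/2) x^k y^(-k)
  reorder : ℕ → Carrier
  reorder k = prodN k (λ i → qpow (ℤ.- + i))

  degree-powA-xy⁻¹ : ∀ j → proj₁ (powA xy⁻¹ j) ≡ 0ℤ
  degree-powA-xy⁻¹ zero    = ≡.refl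
  degree-powA-xy⁻¹ (suc j) = ≡.cong (ℤ._+ 0ℤ) (degree-powA-xy⁻¹ j)

  powA-xy⁻¹-coeff : ∀ j k → proj₂ (powA xy⁻¹ j) k ≈ δ j k * reorder k
  powA-xy⁻¹-coeff zero    zero    = sym (*-identityˡ 1#)
  powA-xy⁻¹-coeff zero    (suc k) = sym (zeroˡ _)
  powA-xy⁻¹-coeff (suc j) zero    = begin
    proj₂ (powA xy⁻¹ (suc j)) 0         ≈⟨ proj₂ (*B-flip xy⁻¹ (powA xy⁻¹ j)) 0 ⟨
    proj₂ (xy⁻¹ *B powA xy⁻¹ j) 0       ≈⟨ *B-coeff-zero xy⁻¹ (powA xy⁻¹ j) ⟩
    proj₂ xy⁻¹ 0 * proj₂ (powA xy⁻¹ j) 0 ≈⟨ trans (*-congʳ (xy⁻¹-coeff 0)) (zeroˡ _) ⟩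
    0#                                  ≈⟨ zeroˡ 1# ⟨
    0# * 1#                             ∎
  powA-xy⁻¹-coeff (suc j) (suc k) = begin
    proj₂ (powA xy⁻¹ (suc j)) (suc k)
      ≈⟨ proj₂ (*B-flip xy⁻¹ (powA xy⁻¹ j)) (suc k) ⟨
    proj₂ (xy⁻¹ *B powA xy⁻¹ j) (suc k)
      ≈⟨ *B-coeff-suc xy⁻¹ (powA xy⁻¹ j) (λ l → xy⁻¹-coeff (2 ℕ.+ l)) k ⟩
    proj₂ xy⁻¹ 0 * proj₂ (powA xy⁻¹ j) (suc k)
      + proj₂ xy⁻¹ 1 * proj₂ (powA xy⁻¹ j) k * qpow (proj₁ (powA xy⁻¹ j) ℤ.- + k)
      ≈⟨ +-cong (*-congʳ (xy⁻¹-coeff 0)) (*-cong (*-cong (xy⁻¹-coeff 1) (powA-xy⁻¹-coeff j k)) (qpow-≡ exponent)) ⟩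
    0# * proj₂ (powA xy⁻¹ j) (suc k) + 1# * (δ j k * reorder k) * qpow (ℤ.- + k)
      ≈⟨ solve 4 (λ a d r e → con (+ 0) :* a :+ con (+ 1) :* (d :* r) :* e := d :* (r :* e)) refl _ _ _ _ ⟩
    δ j k * (reorder k * qpow (ℤ.- + k)) ∎
    where
    exponent : proj₁ (powA xy⁻¹ j) ℤ.- + k ≡ ℤ.- + k
    exponent = ≡.trans (≡.cong (ℤ._- + k) (degree-powA-xy⁻¹ j)) (ℤ.+-identityˡ (ℤ.- + k))

  geometric-coeff : ∀ k → sumTo k (λ j → sgn j * proj₂ (powA xy⁻¹ j) k) ≈ sgn k * reorder k
  geometric-coeff k = trans (sumTo-last k below) (*-congˡ (trans (powA-xy⁻¹-coeff k k) (trans (*-congʳ (δ-refl k)) (*-identityˡ _))))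
    where
    below : ∀ j → j < k → sgn j * proj₂ (powA xy⁻¹ j) k ≈ 0#
    below j j<k = trans (*-congˡ (trans (powA-xy⁻¹-coeff j k) (trans (*-congʳ (δ-≢ (ℕ.<⇒≢ j<k))) (zeroˡ _)))) (zeroʳ _)

  invA-coeff : ∀ k → proj₂ invA k ≈ sgn k * reorder k * qpow (ℤ.- + k)
  invA-coeff k = trans (sumTo-head k (λ _ → *-zeroˡ₂ _ _))
                       (*-cong (trans (*-identityˡ _) (geometric-coeff k)) (qpow-≡ (ℤ.-1*i≡-i (+ k))))

  invA-*A-x+y : invA *A x+y ≋ oneA
  invA-*A-x+y = ≡.refl , coefficient
    where
    exponent : ∀ k → ℤ.- (+ 1) ℤ.- k ≡ ℤ.- (+ 1 ℤ.+ k)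
    exponent = solve-∀

    coefficient : ∀ k → proj₂ (invA *A x+y) k ≈ δ 0 k
    coefficient zero    = trans (*A-x+y-coeff-zero invA) (trans (invA-coeff 0) (*-identity₂ 1#))
    coefficient (suc K) = begin
      proj₂ (invA *A x+y) (suc K)
        ≈⟨ *A-x+y-coeff-suc invA K ⟩
      proj₂ invA (suc K) + proj₂ invA K * qpow (-[1+ 0 ] ℤ.- + K)
        ≈⟨ +-cong (invA-coeff (suc K)) (*-cong (invA-coeff K) (qpow-≡ (exponent (+ K)))) ⟩
      - s * (r * e) * e′ + s * r * e * e′
        ≈⟨ solve 4 (λ s r e e′ → :- s :* (r :* e) :* e′ :+ s :* r :* e :* e′ := con (+ 0)) refl s r e e′ ⟩
      0# ∎
      where
      s = sgn K
      r = reorder K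
      e = qpow (ℤ.- + K)
      e′ = qpow (ℤ.- + suc K)

  coeffA : ℤ → ℕ → Carrier
  coeffA n = proj₂ (binPowA n)

  poch poch⁻ : ℕ → Carrier
  poch  n = prodN n (λ j → 1# - qpow (+ suc j))
  poch⁻ n = prodN n (λ j → 1# - qpow -[1+ j ])

  degree-powA-x+y : ∀ N → proj₁ (powA x+y N) ≡ + N
  degree-powA-x+y zero    = ≡.refl
  degree-powA-x+y (suc N) = ≡.trans (≡.cong (ℤ._+ + 1) (degree-powA-x+y N)) (≡.cong +_ (ℕ.+-comm N 1))

  coeffA⁺-zero : ∀ N → coeffA (+ N) 0 ≈ 1#
  coeffA⁺-zero zero    = refl
  coeffA⁺-zero (suc N) = trans (*A-x+y-coeff-zero (powA x+y N)) (coeffA⁺-zero N)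

  coeffA⁺-pascal : ∀ N K → coeffA (+ suc N) (suc K) ≈ coeffA (+ N) (suc K) + coeffA (+ N) K * qpow (+ N ℤ.- + K)
  coeffA⁺-pascal N K = trans (*A-x+y-coeff-suc (powA x+y N) K)
                             (+-congˡ (*-congˡ (qpow-≡ (≡.cong (ℤ._- + K) (degree-powA-x+y N)))))

  coeffA⁺-vanish : ∀ {N K} → N < K → coeffA (+ N) K ≈ 0#
  coeffA⁺-vanish {zero}  {suc K} _         = refl
  coeffA⁺-vanish {suc N} {suc K} (s≤s N<K) = trans (coeffA⁺-pascal N K)
    (trans (+-cong (coeffA⁺-vanish (ℕ.m<n⇒m<1+n N<K)) (trans (*-congʳ (coeffA⁺-vanish N<K)) (zeroˡ _))) (+-identityʳ 0#))

  coeffA⁺-diag : ∀ N → coeffA (+ N) N ≈ 1#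
  coeffA⁺-diag zero    = refl
  coeffA⁺-diag (suc N) = trans (coeffA⁺-pascal N N)
    (trans (+-cong (coeffA⁺-vanish (ℕ.n<1+n N)) (*-cong (coeffA⁺-diag N) (qpow-≡ (ℤ.+-inverseʳ (+ N)))))
           (trans (+-identityˡ _) (*-identityʳ 1#)))

  coeffA⁺-cleared : ∀ K L → coeffA (+ (K ℕ.+ L)) K * poch K * poch L ≈ poch (K ℕ.+ L)
  coeffA⁺-cleared K       zero    rewrite ℕ.+-identityʳ K =
    trans (*-identityʳ _) (trans (*-congʳ (coeffA⁺-diag K)) (*-identityˡ _))
  coeffA⁺-cleared zero    (suc L) = trans (*-congʳ (trans (*-congʳ (coeffA⁺-zero (suc L))) (*-identityˡ 1#))) (*-identityˡ _)
  coeffA⁺-cleared (suc K) (suc L) = begin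
    coeffA (+ suc N) (suc K) * (pK * (1# - Y)) * (pL * (1# - X))
      ≈⟨ *-congʳ (*-congʳ (trans (coeffA⁺-pascal N K) (+-congˡ (*-congˡ (qpow-≡ ([k+l]-k≡l (+ K) (+ suc L))))))) ⟩
    (A + B * X) * (pK * (1# - Y)) * (pL * (1# - X))
      ≈⟨ solve 6 (λ A B X Y pK pL → (A :+ B :* X) :* (pK :* (con (+ 1) :- Y)) :* (pL :* (con (+ 1) :- X))
                                := A :* (pK :* (con (+ 1) :- Y)) :* pL :* (con (+ 1) :- X)
                                   :+ B :* pK :* (pL :* (con (+ 1) :- X)) :* (X :* (con (+ 1) :- Y)))
                 refl A B X Y pK pL ⟩
    A * (pK * (1# - Y)) * pL * (1# - X) + B * pK * (pL * (1# - X)) * (X * (1# - Y))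
      ≈⟨ +-cong (*-congʳ IH₁) (*-congʳ (coeffA⁺-cleared K (suc L))) ⟩
    poch N * (1# - X) + poch N * (X * (1# - Y))
      ≈⟨ solve 3 (λ P X Y → P :* (con (+ 1) :- X) :+ P :* (X :* (con (+ 1) :- Y)) := P :* (con (+ 1) :- X :* Y)) refl (poch N) X Y ⟩
    poch N * (1# - X * Y)
      ≈⟨ *-congˡ (+-congˡ (-‿cong XY)) ⟨
    poch (suc N) ∎
    where
    N = K ℕ.+ suc L
    A = coeffA (+ N) (suc K)
    B = coeffA (+ N) K
    X = qpow (+ suc L)
    Y = qpow (+ suc K)
    pK = poch K
    pL = poch L

    IH₁ : A * (pK * (1# - Y)) * pL ≈ poch N
    IH₁ = ≡.subst (λ M → coeffA (+ M) (suc K) * poch (suc K) * pL ≈ poch M) (≡.sym (ℕ.+-suc K L)) (coeffA⁺-cleared (suc K) L)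

    XY : qpow (+ suc N) ≈ X * Y
    XY = trans (reflexive (≡.cong (pow q) (ℕ.+-comm (suc K) (suc L)))) (pow-+ q (suc L) (suc K))

  degree-powA-invA : ∀ N → proj₁ (powA invA (suc N)) ≡ -[1+ N ]
  degree-powA-invA zero    = ≡.refl
  degree-powA-invA (suc N) = ≡.trans (≡.cong (ℤ._+ -[1+ 0 ]) (degree-powA-invA N)) (≡.cong (-[1+_] ∘ suc) (ℕ.+-identityʳ N))

  powA-invA-*A-x+y : ∀ N → powA invA (suc N) *A x+y ≋ powA invA N
  powA-invA-*A-x+y N = ≋-trans (*A-assoc (powA invA N) invA x+y)
                               (≋-trans (*A-cong (≋-refl {powA invA N}) invA-*A-x+y) (*A-identityʳ (powA invA N)))

  coeffA⁻-zero : ∀ N → coeffA -[1+ N ] 0 ≈ 1#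
  coeffA⁻-zero N = trans (sym (*A-x+y-coeff-zero (powA invA (suc N)))) (trans (proj₂ (powA-invA-*A-x+y N) 0) (head N))
    where
    head : ∀ N → proj₂ (powA invA N) 0 ≈ 1#
    head zero    = refl
    head (suc N) = coeffA⁻-zero N

  coeffA⁻-pascal : ∀ N K → proj₂ (powA invA N) (suc K) ≈ coeffA -[1+ N ] (suc K) + coeffA -[1+ N ] K * qpow -[1+ (N ℕ.+ K) ]
  coeffA⁻-pascal N K = begin
    proj₂ (powA invA N) (suc K)
      ≈⟨ proj₂ (powA-invA-*A-x+y N) (suc K) ⟨
    proj₂ (powA invA (suc N) *A x+y) (suc K)
      ≈⟨ *A-x+y-coeff-suc (powA invA (suc N)) K ⟩
    coeffA -[1+ N ] (suc K) + coeffA -[1+ N ] K * qpow (proj₁ (powA invA (suc N)) ℤ.- + K)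
      ≡⟨ ≡.cong (λ e → coeffA -[1+ N ] (suc K) + coeffA -[1+ N ] K * qpow e)
                (≡.trans (≡.cong (ℤ._- + K) (degree-powA-invA N)) (-[1+n]-k≡-[1+n+k] (+ N) (+ K))) ⟩
    coeffA -[1+ N ] (suc K) + coeffA -[1+ N ] K * qpow -[1+ (N ℕ.+ K) ] ∎

  coeffA⁻-cleared : ∀ N K → coeffA -[1+ N ] K * poch⁻ N * poch K ≈ poch⁻ (N ℕ.+ K)
  coeffA⁻-cleared N       zero    rewrite ℕ.+-identityʳ N =
    trans (*-identityʳ _) (trans (*-congʳ (coeffA⁻-zero N)) (*-identityˡ _))
  coeffA⁻-cleared zero    (suc K) = begin
    coeffA -[1+ 0 ] (suc K) * 1# * (pK * (1# - b))
      ≈⟨ *-congʳ (*-congʳ (isolate (coeffA⁻-pascal 0 K))) ⟩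
    (0# - B * c) * 1# * (pK * (1# - b))
      ≈⟨ solve 4 (λ B c pK b → (con (+ 0) :- B :* c) :* con (+ 1) :* (pK :* (con (+ 1) :- b))
                             := B :* con (+ 1) :* pK :* (c :* b :- c)) refl B c pK b ⟩
    B * 1# * pK * (c * b - c)
      ≈⟨ *-cong (coeffA⁻-cleared 0 K) (+-congʳ (qpow-inverse -[1+ K ])) ⟩
    poch⁻ K * (1# - c) ∎
    where
    B  = coeffA -[1+ 0 ] K
    c  = qpow -[1+ K ]
    b  = qpow (+ suc K)
    pK = poch K
  coeffA⁻-cleared (suc N) (suc K) = begin
    coeffA -[1+ suc N ] (suc K) * (pN * (1# - a)) * (pK * (1# - b))
      ≈⟨ *-congʳ (*-congʳ (isolate (coeffA⁻-pascal (suc N) K))) ⟩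
    (A - B * c) * (pN * (1# - a)) * (pK * (1# - b))
      ≈⟨ solve 7 (λ A B c a b pN pK → (A :- B :* c) :* (pN :* (con (+ 1) :- a)) :* (pK :* (con (+ 1) :- b))
                                   := A :* pN :* (pK :* (con (+ 1) :- b)) :* (con (+ 1) :- a)
                                      :- B :* (pN :* (con (+ 1) :- a)) :* pK :* (c :* (con (+ 1) :- b)))
                 refl A B c a b pN pK ⟩
    A * pN * (pK * (1# - b)) * (1# - a) - B * (pN * (1# - a)) * pK * (c * (1# - b))
      ≈⟨ +-cong (*-congʳ (coeffA⁻-cleared N (suc K))) (-‿cong (*-congʳ IH₂)) ⟩
    T * (1# - a) - T * (c * (1# - b))
      ≈⟨ solve 4 (λ T a c b → T :* (con (+ 1) :- a) :- T :* (c :* (con (+ 1) :- b))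
                            := T :* (con (+ 1) :- a :- c :+ c :* b)) refl T a c b ⟩
    T * (1# - a - c + c * b)
      ≈⟨ *-congˡ (+-congˡ cb≈a) ⟩
    T * (1# - a - c + a)
      ≈⟨ solve 3 (λ T a c → T :* (con (+ 1) :- a :- c :+ a) := T :* (con (+ 1) :- c)) refl T a c ⟩
    T * (1# - c)
      ≡⟨ ≡.cong (λ n → T * (1# - qpow -[1+ n ])) (≡.sym (ℕ.+-suc N K)) ⟩
    poch⁻ (suc N ℕ.+ suc K) ∎
    where
    A  = coeffA -[1+ N ] (suc K)
    B  = coeffA -[1+ suc N ] K
    T  = poch⁻ (N ℕ.+ suc K)
    a  = qpow -[1+ N ]
    b  = qpow (+ suc K)
    c  = qpow -[1+ (suc N ℕ.+ K) ]
    pN = poch⁻ N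
    pK = poch K

    IH₂ : B * (pN * (1# - a)) * pK ≈ T
    IH₂ = trans (coeffA⁻-cleared (suc N) K) (reflexive (≡.cong poch⁻ (≡.sym (ℕ.+-suc N K))))

    exponent : ∀ n k → ℤ.- (+ 1 ℤ.+ (+ 1 ℤ.+ n ℤ.+ k)) ℤ.+ (+ 1 ℤ.+ k) ≡ ℤ.- (+ 1 ℤ.+ n)
    exponent = solve-∀

    cb≈a : c * b ≈ a
    cb≈a = trans (sym (qpow-+ -[1+ (suc N ℕ.+ K) ] (+ suc K))) (qpow-≡ (exponent (+ N) (+ K)))

  coeff-below : ∀ n K {t} → n ℤ.- -[1+ K ] ≡ + t → coeff n -[1+ K ] ≈ coeffA n t
  coeff-below n K n+1+K≡t with n ℤ.- -[1+ K ] | n+1+K≡t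
  ... | _ | ≡.refl = proj₂ (binPowB≋binPowA n) _

  coeff-beyond : ∀ n K {t} → n ℤ.- -[1+ K ] ≡ -[1+ t ] → coeff n -[1+ K ] ≡ 0#
  coeff-beyond n K n+1+K≡-1-t with n ℤ.- -[1+ K ] | n+1+K≡-1-t
  ... | _ | ≡.refl = ≡.refl

  module QBinomial (inv : ℤ → Carrier) (inv-spec : ∀ e → e ≢ 0ℤ → (1# - qpow e) * inv e ≈ 1#) where
    open Binom inv

    -- qbinom with n - k supplied separately: for variable n, k the test on pole (n - k) does not compute
    qbinom′ : ℤ → ℤ → ℤ → Carrier
    qbinom′ n k d = if pole n <ᵇ pole k ℕ.+ pole d then 0# else val n * valInv k * valInv d

    qbinom-diff : ∀ n k {d} → n ℤ.- k ≡ d → qbinom n k ≡ qbinom′ n k d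
    qbinom-diff n k = ≡.cong (qbinom′ n k)

    poch-inverse : ∀ K → poch K * valInv (+ K) ≈ 1#
    poch-inverse K = prodN-inverse K (λ j → inv-spec (+ suc j) (λ ()))

    poch⁻-inverse : ∀ N → poch⁻ N * val -[1+ N ] ≈ 1#
    poch⁻-inverse N = prodN-inverse N (λ j → inv-spec -[1+ j ] (λ ()))

    negative-value≈coeffA : ∀ N K → val -[1+ N ] * valInv (+ K) * poch⁻ (N ℕ.+ K) ≈ coeffA -[1+ N ] K
    negative-value≈coeffA N K = trans (solve 3 (λ a b p → a :* b :* p := p :* a :* b) refl _ _ _)
                                      (cancel-units (poch⁻-inverse N) (poch-inverse K) (coeffA⁻-cleared N K))

    qbinom≈coeff⁺⁺-≤ : ∀ {N K} → K ≤ N → qbinom (+ N) (+ K) ≈ coeff (+ N) (+ K)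
    qbinom≈coeff⁺⁺-≤ {K = K} K≤N with ℕ.m≤n⇒∃[o]m+o≡n K≤N
    ... | L , ≡.refl = trans (reflexive (qbinom-diff (+ (K ℕ.+ L)) (+ K) ([k+l]-k≡l (+ K) (+ L))))
                             (cancel-units (poch-inverse K) (poch-inverse L) (coeffA⁺-cleared K L))

    qbinom≈coeff⁺⁺-> : ∀ {N K} → N < K → qbinom (+ N) (+ K) ≈ coeff (+ N) (+ K)
    qbinom≈coeff⁺⁺-> {N} N<K with ℕ.m≤n⇒∃[o]m+o≡n N<K
    ... | L , ≡.refl = trans (reflexive (qbinom-diff (+ N) (+ (suc N ℕ.+ L)) (exponent (+ N) (+ L)))) (sym (coeffA⁺-vanish N<K))
      where
      exponent : ∀ n l → n ℤ.- (+ 1 ℤ.+ n ℤ.+ l) ≡ ℤ.- (+ 1 ℤ.+ l)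
      exponent = solve-∀

    qbinom≈coeff⁺⁻ : ∀ N K → qbinom (+ N) -[1+ K ] ≈ coeff (+ N) -[1+ K ]
    qbinom≈coeff⁺⁻ N K = sym (trans (proj₂ (binPowB≋binPowA (+ N)) (N ℕ.+ suc K)) (coeffA⁺-vanish (ℕ.m<m+n N (s≤s z≤n))))

    qbinom≈coeff⁻⁺ : ∀ N K → qbinom -[1+ N ] (+ K) ≈ coeff -[1+ N ] (+ K)
    qbinom≈coeff⁻⁺ N K = trans (reflexive (qbinom-diff -[1+ N ] (+ K) (-[1+n]-k≡-[1+n+k] (+ N) (+ K)))) (negative-value≈coeffA N K)

    qbinom≈coeff⁻⁻-≤ : ∀ {N K} → N ≤ K → qbinom -[1+ N ] -[1+ K ] ≈ coeff -[1+ N ] -[1+ K ]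
    qbinom≈coeff⁻⁻-≤ {N} N≤K with ℕ.m≤n⇒∃[o]m+o≡n N≤K
    ... | L , ≡.refl = begin
      qbinom -[1+ N ] -[1+ N ℕ.+ L ]                       ≡⟨ qbinom-diff -[1+ N ] -[1+ N ℕ.+ L ] difference ⟩
      val -[1+ N ] * poch⁻ (N ℕ.+ L) * valInv (+ L)         ≈⟨ solve 3 (λ a p b → a :* p :* b := a :* b :* p) refl _ _ _ ⟩
      val -[1+ N ] * valInv (+ L) * poch⁻ (N ℕ.+ L)         ≈⟨ negative-value≈coeffA N L ⟩
      coeffA -[1+ N ] L                                    ≈⟨ coeff-below -[1+ N ] (N ℕ.+ L) difference ⟨
      coeff -[1+ N ] -[1+ N ℕ.+ L ]                        ∎
      where
      exponent : ∀ n l → ℤ.- (+ 1 ℤ.+ n) ℤ.- ℤ.- (+ 1 ℤ.+ (n ℤ.+ l)) ≡ l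
      exponent = solve-∀

      difference : -[1+ N ] ℤ.- -[1+ N ℕ.+ L ] ≡ + L
      difference = exponent (+ N) (+ L)

    qbinom≈coeff⁻⁻-> : ∀ {N K} → K < N → qbinom -[1+ N ] -[1+ K ] ≈ coeff -[1+ N ] -[1+ K ]
    qbinom≈coeff⁻⁻-> {K = K} K<N with ℕ.m≤n⇒∃[o]m+o≡n K<N
    ... | L , ≡.refl = reflexive (≡.trans (qbinom-diff -[1+ suc K ℕ.+ L ] -[1+ K ] difference)
                                          (≡.sym (coeff-beyond -[1+ suc K ℕ.+ L ] K difference)))
      where
      exponent : ∀ k l → ℤ.- (+ 1 ℤ.+ (+ 1 ℤ.+ k ℤ.+ l)) ℤ.- ℤ.- (+ 1 ℤ.+ k) ≡ ℤ.- (+ 1 ℤ.+ l)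
      exponent = solve-∀

      difference : -[1+ suc K ℕ.+ L ] ℤ.- -[1+ K ] ≡ -[1+ L ]
      difference = exponent (+ K) (+ L)

theorem5p4 : ∀ {c ℓ : Level} (R : CommutativeRing c ℓ) →
    let open CommutativeRing R in
    (q q⁻ : Carrier) → q * q⁻ ≈ 1# →
    (inv : ℤ → Carrier) →
    (∀ e → e ≢ 0ℤ → (1# - QTorus.qpow R q q⁻ e) * inv e ≈ 1#) →
    ∀ (n k : ℤ) →
    QTorus.Binom.qbinom R q q⁻ inv n k ≈ QTorus.coeff R q q⁻ n k
theorem5p4 R q q⁻ q*q⁻≈1 inv inv-spec = qbinom≈coeff
  where
  open CommutativeRing R using (_≈_)
  open QTorus R q q⁻ using (coeff; module Binom)
  open Binom inv using (qbinom)
  open BinomialExpansion.QBinomial R q q⁻ q*q⁻≈1 inv inv-spec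

  qbinom≈coeff : ∀ n k → qbinom n k ≈ coeff n k
  qbinom≈coeff (+ N)    (+ K)    with ℕ.≤-<-connex K N
  ... | inj₁ K≤N = qbinom≈coeff⁺⁺-≤ K≤N
  ... | inj₂ N<K = qbinom≈coeff⁺⁺-> N<K
  qbinom≈coeff (+ N)    -[1+ K ] = qbinom≈coeff⁺⁻ N K
  qbinom≈coeff -[1+ N ] (+ K)    = qbinom≈coeff⁻⁺ N K
  qbinom≈coeff -[1+ N ] -[1+ K ] with ℕ.≤-<-connex N K
  ... | inj₁ N≤K = qbinom≈coeff⁻⁻-≤ N≤K
  ... | inj₂ K<N = qbinom≈coeff⁻⁻-> K<N
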